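{- Let $P$ be a finite poset with $n\geq 2$ elements, let $f$ be a linear extension of $P$, and let $a$ be a minimal element of $P$. Put $b=a\oplus_f 1$ and define $f_a\colon\pi_{a,b}\to\{0,\dots,n-2\}$ by $f_a(\{x\})=f(x)$ if $f(x)<f(a)$, $f_a(\{a,b\})=\min(f(a),f(b))$, and $f_a(\{x\})=f(x)-1$ if $f(x)>f(a)+1$. Then $f_a$ is a linear extension of the poset $(\pi_{a,b},\leq)$.
   Context: A linear extension of an $m$-element poset $Q$ is an order-preserving bijection $Q\to\{0,\dots,m-1\}$; $x\oplus_f k=f^{ -1}(f(x)\oplus k)$ with $\oplus$ addition modulo $n$. For distinct $a,b$, $\pi_{a,b}=\{\{a,b\}\}\cup\{\{x\}:x\in P\setminus\{a,b\}\}$; here it is an order-preserving partition of $P$, i.e. the class partition of an order-congruence $\rho$ (an equivalence relation such that every $\rho$-circle — a sequence $x_0,\dots,x_m$, $x_0=x_m$, with each step either within a $\rho$-class or strictly increasing — stays in one class). Its order is the quotient order: $\rho[x]\leq\rho[y]$ iff there is a sequence $x=x_0,\dots,x_m=y$ with each step either within a $\rho$-class or strictly increasing in $P$. -}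

module Defs where

open import Data.Nat using (ℕ; zero; suc; _+_; _∸_; _<_; _≤_; _<ᵇ_; _⊓_)
open import Data.Nat.DivMod using (_%_)
import Data.Nat.Properties
open import Data.Bool using (if_then_else_)
open import Data.Product using (_×_; ∃)
open import Data.Sum using (_⊎_)
open import Relation.Binary.PropositionalEquality using (_≡_; _≢_; cong)
open import Relation.Binary.Definitions using (DecidableEquality)
open import Relation.Binary.Construct.Closure.ReflexiveTransitive using (Star)
open import Relation.Nullary using (Dec; yes; no; ¬_)
open import Relation.Nullary.Decidable using (map′)

-- addition modulo n on ℕ (for n = 0 we just return the sum; never used since n ≥ 2)
_⊕[_]_ : ℕ → ℕ → ℕ → ℕ
k ⊕[ zero ] j = k + j
k ⊕[ suc n ] j = (k + j) % suc n

Strict : {X : Set} → (X → X → Set) → X → X → Set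
Strict _≤_ x y = (x ≤ y) × (x ≢ y)

Minimal : {X : Set} → (X → X → Set) → X → Set
Minimal _≤_ a = ∀ x → ¬ Strict _≤_ x a

-- g is a linear extension of an m-element poset whose elements are the
-- ≈-classes of X, ordered by ≤ (on representatives):
-- an order-preserving bijection onto {0,…,m-1}, given on representatives.
record IsLinearExtension {X : Set} (_≈_ _⊑_ : X → X → Set) (m : ℕ) (g : X → ℕ) : Set where
  field
    bounded    : ∀ x → g x < m
    respects   : ∀ {x y} → x ≈ y → g x ≡ g y
    injective  : ∀ {x y} → g x ≡ g y → x ≈ y
    surjective : ∀ k → k < m → ∃ λ x → g x ≡ k
    monotone   : ∀ {x y} → x ⊑ y → g x ≤ g y

decEqFromInj : {X : Set} (g : X → ℕ) → (∀ {x y} → g x ≡ g y → x ≡ y) → DecidableEquality X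
decEqFromInj g inj x y = map′ inj (cong g) (Data.Nat.Properties._≟_ (g x) (g y))

-- the partition π_{a,b}, as the equivalence relation "same block"
SameBlock : {X : Set} → X → X → X → X → Set
SameBlock a b x y = (x ≡ y) ⊎ ((x ≡ a × y ≡ b) ⊎ (x ≡ b × y ≡ a))

-- quotient order on blocks: x ≤ y iff there is a chain x = x₀,…,x_m = y whose
-- steps stay in a block or strictly increase in P
QuotStep : {X : Set} → (X → X → Set) → X → X → X → X → Set
QuotStep _≤_ a b x y = SameBlock a b x y ⊎ Strict _≤_ x y

QuotLeq : {X : Set} → (X → X → Set) → X → X → X → X → Set
QuotLeq _≤_ a b = Star (QuotStep _≤_ a b)

-- f_a, given on representatives (decidable equality from injectivity of f):
--   f_a({a,b}) = min(f a, f b);  f_a({x}) = f x if f x < f a;  f_a({x}) = f x - 1 otherwise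
--   (for x ∉ {a,b} the "otherwise" case is exactly f x > f a + 1).
fₐ : {X : Set} (_≟X_ : DecidableEquality X) (f : X → ℕ) (a b : X) → X → ℕ
fₐ _≟X_ f a b x with x ≟X a | x ≟X b
... | yes _ | _     = f a ⊓ f b
... | no _  | yes _ = f a ⊓ f b
... | no _  | no _  = if f x <ᵇ f a then f x else f x ∸ 1

module Submission where

-- Write c = f a and d = f b = c ⊕ 1.  On representatives, fₐ is
-- the composite  collapse c d ∘ f  of f with a map on values that sends both
-- c and d to c ⊓ d, fixes the values below c and lowers the other values by
-- one.  The theorem therefore splits into two independent parts.
--   * Arithmetic: when d is the cyclic successor of c modulo 2+m, the map
--     collapse c d is an "(m, c, d)-collapse" (IsCollapse): it maps the values
--     0..m+1 onto 0..m, identifies exactly c with d, and is monotone on every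
--     pair k < l with l ≠ c.  Since d is either c+1 (adjacent case) or c = m+1,
--     d = 0 (wrap-around case), this is checked on the two regimes separately.
--   * Order theory: composing a linear extension f with a collapse merging the
--     values of a minimal element a and of b yields a linear extension of the
--     quotient by π_{a,b}.  Minimality of a is what makes the monotonicity
--     exception l = c harmless: a strict step x < y in P never ends at y = a.
-- The theorem combines the two via the identity fₐ = collapse (f a) (f b) ∘ f.

open import Defs
open import Data.Nat using (ℕ; zero; suc; _≤_; _<_; _∸_; _<ᵇ_; _⊓_; z≤n; s≤s; z<s; s≤s⁻¹; _≟_; _≤?_)
open import Data.Nat.Properties
  using (<⇒<ᵇ; <ᵇ⇒<; <-asym; <-irrefl; <-trans; ≤-trans; ≤-refl; ≤-reflexive; ≤-antisym; <⇒≤; ≰⇒>;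
         ≤∧≢⇒<; m≤n⇒m<n∨m≡n; m≤n⇒m⊓n≡m; n≤1+n; m<n⇒m<1+n; n≮0; +-comm)
open import Data.Nat.DivMod using (_%_; m<n⇒m%n≡m; n%n≡0)
open import Data.Bool using (true; false; if_then_else_)
open import Data.Product using (_×_; _,_; ∃)
open import Data.Sum using (inj₁; inj₂)
open import Data.Empty using (⊥-elim)
open import Function using (_∘_)
open import Relation.Binary.PropositionalEquality
  using (_≡_; _≢_; refl; sym; trans; cong; subst; module ≡-Reasoning)
open import Relation.Binary.Definitions using (DecidableEquality)
open import Relation.Binary.Structures using (IsPartialOrder)
open import Relation.Binary.Construct.Closure.ReflexiveTransitive using (ε; _◅_)
open import Relation.Nullary using (yes; no)

collapse : ℕ → ℕ → ℕ → ℕ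
collapse c d k with k ≟ c | k ≟ d
... | yes _ | _     = c ⊓ d
... | no _  | yes _ = c ⊓ d
... | no _  | no _  = if k <ᵇ c then k else k ∸ 1

collapse-left : ∀ c d → collapse c d c ≡ c ⊓ d
collapse-left c d with c ≟ c
... | yes _   = refl
... | no c≢c = ⊥-elim (c≢c refl)

collapse-right : ∀ c d → collapse c d d ≡ c ⊓ d
collapse-right c d with d ≟ c | d ≟ d
... | yes _ | _       = refl
... | no _  | yes _   = refl
... | no _  | no d≢d = ⊥-elim (d≢d refl)

collapse-merges : ∀ c d → collapse c d c ≡ collapse c d d
collapse-merges c d = trans (collapse-left c d) (sym (collapse-right c d))

collapse-outside : ∀ {c d k} → k ≢ c → k ≢ d → collapse c d k ≡ (if k <ᵇ c then k else k ∸ 1)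
collapse-outside {c} {d} {k} k≢c k≢d with k ≟ c | k ≟ d
... | yes k≡c | _       = ⊥-elim (k≢c k≡c)
... | no _    | yes k≡d = ⊥-elim (k≢d k≡d)
... | no _    | no _    = refl

shift-below : ∀ {k c} → k < c → (if k <ᵇ c then k else k ∸ 1) ≡ k
shift-below {k} {c} k<c with k <ᵇ c | <⇒<ᵇ k<c
... | true | _ = refl

shift-above : ∀ {k c} → c < k → (if k <ᵇ c then k else k ∸ 1) ≡ k ∸ 1
shift-above {k} {c} c<k with k <ᵇ c | <ᵇ⇒< k c
... | true  | k<c = ⊥-elim (<-asym (k<c _) c<k)
... | false | _   = refl

fₐ-collapse : {X : Set} (_≟X_ : DecidableEquality X) (f : X → ℕ) → (∀ {x y} → f x ≡ f y → x ≡ y) →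
              (a b x : X) → fₐ _≟X_ f a b x ≡ collapse (f a) (f b) (f x)
fₐ-collapse _≟X_ f f-inj a b x with x ≟X a | x ≟X b
... | yes refl | _        = sym (collapse-left (f a) (f b))
... | no _     | yes refl = sym (collapse-right (f a) (f b))
... | no x≢a   | no x≢b   = sym (collapse-outside (x≢a ∘ f-inj) (x≢b ∘ f-inj))

record IsCollapse (m c d : ℕ) (h : ℕ → ℕ) : Set where
  field
    bounded    : ∀ k → k < suc (suc m) → h k < suc m
    merges     : h c ≡ h d
    injective  : ∀ k l → k < suc (suc m) → l < suc (suc m) → h k ≡ h l → SameBlock c d k l
    surjective : ∀ j → j < suc m → ∃ λ k → k < suc (suc m) × h k ≡ j
    monotone   : ∀ k l → k < l → l < suc (suc m) → l ≢ c → h k ≤ h l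

adjacent-below : ∀ {c k} → k ≤ c → collapse c (suc c) k ≡ k
adjacent-below {c} {k} k≤c with m≤n⇒m<n∨m≡n k≤c
... | inj₂ refl = trans (collapse-left k (suc k)) (m≤n⇒m⊓n≡m (n≤1+n k))
... | inj₁ k<c  = trans (collapse-outside (λ k≡c → <-irrefl k≡c k<c)
                                          (λ k≡1+c → <-asym k<c (≤-reflexive (sym k≡1+c))))
                        (shift-below k<c)

adjacent-above : ∀ {c k} → c ≤ k → collapse c (suc c) (suc k) ≡ k
adjacent-above {c} {k} c≤k with m≤n⇒m<n∨m≡n c≤k
... | inj₂ refl = trans (collapse-right c (suc c)) (m≤n⇒m⊓n≡m (n≤1+n c))
... | inj₁ c<k  = trans (collapse-outside (λ 1+k≡c → <-asym c<k (≤-reflexive 1+k≡c))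
                                          (λ 1+k≡1+c → <-irrefl (sym (cong (_∸ 1) 1+k≡1+c)) c<k))
                        (shift-above (m<n⇒m<1+n c<k))

data AdjacentCase (c : ℕ) : ℕ → Set where
  below : ∀ {k} → k ≤ c → AdjacentCase c k
  above : ∀ {k} → c ≤ k → AdjacentCase c (suc k)

adjacentCase : ∀ c k → AdjacentCase c k
adjacentCase c k with k ≤? c
... | yes k≤c = below k≤c
... | no k≰c with k | ≰⇒> k≰c
...   | suc k′ | c<1+k′ = above (s≤s⁻¹ c<1+k′)

collapse-adjacent : ∀ {m c} → c ≤ m → IsCollapse m c (suc c) (collapse c (suc c))
collapse-adjacent {m} {c} c≤m = record
  { bounded    = bounded
  ; merges     = collapse-merges c (suc c)
  ; injective  = injective
  ; surjective = surjective
  ; monotone   = monotone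
  }
  where
  h = collapse c (suc c)

  bounded : ∀ k → k < suc (suc m) → h k < suc m
  bounded k k<n with adjacentCase c k
  ... | below k≤c rewrite adjacent-below k≤c = s≤s (≤-trans k≤c c≤m)
  ... | above c≤k rewrite adjacent-above c≤k = s≤s⁻¹ k<n

  meet : ∀ {k l} → k ≤ c → c ≤ l → k ≡ l → k ≡ c × l ≡ c
  meet k≤c c≤l k≡l = k≡c , trans (sym k≡l) k≡c
    where k≡c = ≤-antisym k≤c (subst (c ≤_) (sym k≡l) c≤l)

  injective : ∀ k l → k < suc (suc m) → l < suc (suc m) → h k ≡ h l → SameBlock c (suc c) k l
  injective k l _ _ hk≡hl with adjacentCase c k | adjacentCase c l
  ... | below k≤c | below l≤c =
    inj₁ (trans (sym (adjacent-below k≤c)) (trans hk≡hl (adjacent-below l≤c)))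
  ... | above c≤k | above c≤l =
    inj₁ (cong suc (trans (sym (adjacent-above c≤k)) (trans hk≡hl (adjacent-above c≤l))))
  ... | below k≤c | above c≤l
    with meet k≤c c≤l (trans (sym (adjacent-below k≤c)) (trans hk≡hl (adjacent-above c≤l)))
  ...   | k≡c , l≡c = inj₂ (inj₁ (k≡c , cong suc l≡c))
  injective k l _ _ hk≡hl | above c≤k | below l≤c
    with meet l≤c c≤k (trans (sym (adjacent-below l≤c)) (trans (sym hk≡hl) (adjacent-above c≤k)))
  ...   | l≡c , k≡c = inj₂ (inj₂ (cong suc k≡c , l≡c))

  surjective : ∀ j → j < suc m → ∃ λ k → k < suc (suc m) × h k ≡ j
  surjective j j<1+m with j ≤? c
  ... | yes j≤c = j , m<n⇒m<1+n j<1+m , adjacent-below j≤c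
  ... | no j≰c  = suc j , s≤s j<1+m , adjacent-above (<⇒≤ (≰⇒> j≰c))

  monotone : ∀ k l → k < l → l < suc (suc m) → l ≢ c → h k ≤ h l
  monotone k l k<l _ _ with adjacentCase c k | adjacentCase c l
  ... | below k≤c | below l≤c rewrite adjacent-below k≤c | adjacent-below l≤c = <⇒≤ k<l
  ... | below k≤c | above c≤l rewrite adjacent-below k≤c | adjacent-above c≤l = ≤-trans k≤c c≤l
  ... | above c≤k | below l≤c = ⊥-elim (<-irrefl refl (≤-trans (<-trans (s≤s c≤k) k<l) l≤c))
  ... | above c≤k | above c≤l rewrite adjacent-above c≤k | adjacent-above c≤l = <⇒≤ (s≤s⁻¹ k<l)

wrap-bottom : ∀ m → collapse (suc m) 0 0 ≡ 0
wrap-bottom m = collapse-right (suc m) 0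

wrap-top : ∀ m → collapse (suc m) 0 (suc m) ≡ 0
wrap-top m = collapse-left (suc m) 0

wrap-middle : ∀ {m k} → 0 < k → k < suc m → collapse (suc m) 0 k ≡ k
wrap-middle 0<k k<1+m =
  trans (collapse-outside (λ k≡1+m → <-irrefl k≡1+m k<1+m) (λ k≡0 → <-irrefl (sym k≡0) 0<k))
        (shift-below k<1+m)

data WrapCase (m : ℕ) : ℕ → Set where
  bottom : WrapCase m zero
  top    : WrapCase m (suc m)
  middle : ∀ {k} → 0 < k → k < suc m → WrapCase m k

wrapCase : ∀ m k → k < suc (suc m) → WrapCase m k
wrapCase m zero    _ = bottom
wrapCase m (suc k) k<n with suc k ≟ suc m
... | yes refl = top
... | no k≢m   = middle z<s (≤∧≢⇒< (s≤s⁻¹ k<n) k≢m)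

collapse-wrap : ∀ m → IsCollapse m (suc m) 0 (collapse (suc m) 0)
collapse-wrap m = record
  { bounded    = bounded
  ; merges     = collapse-merges (suc m) 0
  ; injective  = injective
  ; surjective = surjective
  ; monotone   = monotone
  }
  where
  h = collapse (suc m) 0

  bounded : ∀ k → k < suc (suc m) → h k < suc m
  bounded k k<n with wrapCase m k k<n
  ... | bottom rewrite wrap-bottom m = z<s
  ... | top    rewrite wrap-top m = z<s
  ... | middle 0<k k<1+m rewrite wrap-middle 0<k k<1+m = k<1+m

  end≢middle : ∀ e {k} → h e ≡ 0 → 0 < k → k < suc m → h e ≢ h k
  end≢middle _ he≡0 0<k k<1+m he≡hk = <-irrefl (trans (sym he≡0) (trans he≡hk (wrap-middle 0<k k<1+m))) 0<k

  injective : ∀ k l → k < suc (suc m) → l < suc (suc m) → h k ≡ h l → SameBlock (suc m) 0 k l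
  injective k l k<n l<n hk≡hl with wrapCase m k k<n | wrapCase m l l<n
  ... | bottom | bottom = inj₁ refl
  ... | bottom | top    = inj₂ (inj₂ (refl , refl))
  ... | top    | bottom = inj₂ (inj₁ (refl , refl))
  ... | top    | top    = inj₁ refl
  ... | middle 0<k k<1+m | middle 0<l l<1+m =
    inj₁ (trans (sym (wrap-middle 0<k k<1+m)) (trans hk≡hl (wrap-middle 0<l l<1+m)))
  ... | bottom | middle 0<l l<1+m = ⊥-elim (end≢middle 0 (wrap-bottom m) 0<l l<1+m hk≡hl)
  ... | top    | middle 0<l l<1+m = ⊥-elim (end≢middle (suc m) (wrap-top m) 0<l l<1+m hk≡hl)
  ... | middle 0<k k<1+m | bottom = ⊥-elim (end≢middle 0 (wrap-bottom m) 0<k k<1+m (sym hk≡hl))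
  ... | middle 0<k k<1+m | top    = ⊥-elim (end≢middle (suc m) (wrap-top m) 0<k k<1+m (sym hk≡hl))

  surjective : ∀ j → j < suc m → ∃ λ k → k < suc (suc m) × h k ≡ j
  surjective zero    _      = zero , z<s , wrap-bottom m
  surjective (suc j) j<1+m = suc j , m<n⇒m<1+n j<1+m , wrap-middle z<s j<1+m

  monotone : ∀ k l → k < l → l < suc (suc m) → l ≢ suc m → h k ≤ h l
  monotone k l k<l l<n l≢top with wrapCase m l l<n
  ... | bottom = ⊥-elim (n≮0 k<l)
  ... | top    = ⊥-elim (l≢top refl)
  ... | middle 0<l l<1+m with wrapCase m k (<-trans k<l l<n)
  ...   | bottom rewrite wrap-bottom m = z≤n
  ...   | top    = ⊥-elim (<-asym k<l l<1+m)
  ...   | middle 0<k k<1+m rewrite wrap-middle 0<k k<1+m | wrap-middle 0<l l<1+m = <⇒≤ k<l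

data Successor (m : ℕ) : ℕ → ℕ → Set where
  adjacent : ∀ {c} → c ≤ m → Successor m c (suc c)
  wraps    : Successor m (suc m) 0

successor : ∀ {m c d} → c < suc (suc m) → d ≡ c ⊕[ suc (suc m) ] 1 → Successor m c d
successor {m} {c} c<n refl with c ≤? m
... | yes c≤m = subst (Successor m c) (sym c⊕1≡1+c) (adjacent c≤m)
  where
  c⊕1≡1+c : c ⊕[ suc (suc m) ] 1 ≡ suc c
  c⊕1≡1+c = trans (cong (_% suc (suc m)) (+-comm c 1)) (m<n⇒m%n≡m (s≤s (s≤s c≤m)))
... | no c≰m with ≤-antisym (s≤s⁻¹ c<n) (≰⇒> c≰m)
...   | refl = subst (Successor m (suc m)) (sym top⊕1≡0) wraps
  where
  top⊕1≡0 : suc m ⊕[ suc (suc m) ] 1 ≡ 0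
  top⊕1≡0 = trans (cong (_% suc (suc m)) (+-comm (suc m) 1)) (n%n≡0 (suc (suc m)))

collapse-successor : ∀ {m c d} → c < suc (suc m) → d ≡ c ⊕[ suc (suc m) ] 1 →
                     IsCollapse m c d (collapse c d)
collapse-successor c<n d≡c⊕1 with successor c<n d≡c⊕1
... | adjacent c≤m = collapse-adjacent c≤m
... | wraps        = collapse-wrap _

SameBlock-reflect : {X : Set} (f : X → ℕ) → (∀ {x y} → f x ≡ f y → x ≡ y) →
                    ∀ {a b x y} → SameBlock (f a) (f b) (f x) (f y) → SameBlock a b x y
SameBlock-reflect f f-inj (inj₁ e)                = inj₁ (f-inj e)
SameBlock-reflect f f-inj (inj₂ (inj₁ (e₁ , e₂))) = inj₂ (inj₁ (f-inj e₁ , f-inj e₂))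
SameBlock-reflect f f-inj (inj₂ (inj₂ (e₁ , e₂))) = inj₂ (inj₂ (f-inj e₁ , f-inj e₂))

collapse-linear-extension :
  {X : Set} (_≤P_ : X → X → Set) (m : ℕ) (f : X → ℕ) →
  IsLinearExtension _≡_ _≤P_ (suc (suc m)) f →
  (a b : X) → Minimal _≤P_ a →
  (h : ℕ → ℕ) → IsCollapse m (f a) (f b) h →
  (g : X → ℕ) → (∀ x → g x ≡ h (f x)) →
  IsLinearExtension (SameBlock a b) (QuotLeq _≤P_ a b) (suc m) g
collapse-linear-extension _≤P_ m f lin a b a-min h col g g≡hf = record
  { bounded    = λ x → subst (_< suc m) (sym (g≡hf x)) (C.bounded (f x) (L.bounded x))
  ; respects   = respects
  ; injective  = injective
  ; surjective = surjective
  ; monotone   = monotone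
  }
  where
  module L = IsLinearExtension lin
  module C = IsCollapse col
  open ≡-Reasoning

  g-merges : g a ≡ g b
  g-merges = begin
    g a     ≡⟨ g≡hf a ⟩
    h (f a) ≡⟨ C.merges ⟩
    h (f b) ≡⟨ sym (g≡hf b) ⟩
    g b     ∎

  respects : ∀ {x y} → SameBlock a b x y → g x ≡ g y
  respects (inj₁ refl)                 = refl
  respects (inj₂ (inj₁ (refl , refl))) = g-merges
  respects (inj₂ (inj₂ (refl , refl))) = sym g-merges

  injective : ∀ {x y} → g x ≡ g y → SameBlock a b x y
  injective {x} {y} gx≡gy =
    SameBlock-reflect f L.injective
      (C.injective (f x) (f y) (L.bounded x) (L.bounded y)
        (trans (sym (g≡hf x)) (trans gx≡gy (g≡hf y))))

  surjective : ∀ j → j < suc m → ∃ λ x → g x ≡ j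
  surjective j j<1+m with C.surjective j j<1+m
  ... | k , k<n , hk≡j with L.surjective k k<n
  ...   | x , fx≡k = x , (begin
    g x     ≡⟨ g≡hf x ⟩
    h (f x) ≡⟨ cong h fx≡k ⟩
    h k     ≡⟨ hk≡j ⟩
    j       ∎)

  not-above-a : ∀ {x y} → Strict _≤P_ x y → f y ≢ f a
  not-above-a {x} (x≤y , x≢y) fy≡fa =
    a-min x (subst (x ≤P_) y≡a x≤y , λ x≡a → x≢y (trans x≡a (sym y≡a)))
    where y≡a = L.injective fy≡fa

  step : ∀ {x y} → QuotStep _≤P_ a b x y → g x ≤ g y
  step (inj₁ same) = ≤-reflexive (respects same)
  step {x} {y} (inj₂ x<y@(x≤y , x≢y)) =
    via-values (C.monotone (f x) (f y) (≤∧≢⇒< (L.monotone x≤y) (x≢y ∘ L.injective))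
                        (L.bounded y) (not-above-a x<y))
    where
    via-values : h (f x) ≤ h (f y) → g x ≤ g y
    via-values hfx≤hfy rewrite g≡hf x | g≡hf y = hfx≤hfy

  monotone : ∀ {x y} → QuotLeq _≤P_ a b x y → g x ≤ g y
  monotone ε        = ≤-refl
  monotone (s ◅ ss) = ≤-trans (step s) (monotone ss)

lemma24 : {X : Set} (_≤P_ : X → X → Set) → IsPartialOrder _≡_ _≤P_ →
          (n : ℕ) → 2 ≤ n →
          (f : X → ℕ) (lin : IsLinearExtension _≡_ _≤P_ n f) →
          (a : X) → Minimal _≤P_ a →
          (b : X) → f b ≡ f a ⊕[ n ] 1 →
          IsLinearExtension (SameBlock a b) (QuotLeq _≤P_ a b) (n ∸ 1)
            (fₐ (decEqFromInj f (IsLinearExtension.injective lin)) f a b)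
lemma24 _≤P_ _ (suc (suc m)) (s≤s (s≤s z≤n)) f lin a a-min b fb≡fa⊕1 =
  collapse-linear-extension _≤P_ m f lin a b a-min
    (collapse (f a) (f b)) (collapse-successor (bounded a) fb≡fa⊕1)
    _ (fₐ-collapse (decEqFromInj f injective) f injective a b)
  where open IsLinearExtension lin
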